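{- Let $N$ and $v$ be integers with $2\le v\le N+1$. If $v\in\{2,N,N+1\}$, then the type $\mathcal L(N,v)$ is well-defined (all prescribed multiplicities are nonnegative integers) and admissible.
   Context: Let $f=\lfloor\frac{N+1}{v}\rfloor$, $d=(f+1)v-N$; binomial coefficients with negative lower index are $0$ and empty sums are $0$. A $v$-shape is a multiset of $v$ nonnegative integers; $\mu_M(x)$ is the number of entries of the shape $M$ equal to $x$. A multiset $\mathcal M$ of $v$-shapes is admissible if $\sum_{M\in\mathcal M}\mu_M(x)\le\binom{N}{x}$ for $0\le x\le N$. For $0\le i\le f$, $L_i(N,v)$ is the $v$-shape consisting of the entry $i$ together with $v-1$ further entries summing to $N-i$ and pairwise differing by at most $1$. If $v\ge3$ and $N\equiv v-1\pmod v$, $L_*(N,v)$ is the $v$-shape with two entries $f-1$, $v-3$ entries $f$ and one entry $f+1$. Let $s=\sum_{i=f-d+2}^{f-1}(d-f-1+i)\binom{N}{i}$ and $s'=\sum_{i=f-v+1}^{f-2}(v-f+i)\binom{N}{i}$. $\mathcal L(N,v)$ consists of: $\binom{N}{i}$ copies of $L_i(N,v)$ for $0\le i\le f-2$; if $N\not\equiv v-1\pmod v$, additionally $\binom{N}{f-1}$ copies of $L_{f-1}(N,v)$ and $\lfloor\frac1d(\binom{N}{f}-s)\rfloor$ copies of $L_f(N,v)$; if $N\equiv v-1\pmod v$, additionally $\binom{N}{f-1}-2\lceil\frac{s'}{v+1}\rceil$ copies of $L_{f-1}(N,v)$ and $\lceil\frac{s'}{v+1}\rceil$ copies of $L_*(N,v)$.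 -}

module Defs where

open import Data.Nat as ℕ using (ℕ; zero; suc; _∸_; _≡ᵇ_)
import Data.Nat.DivMod as ℕD
open import Data.Nat.Combinatorics using (_C_)
open import Data.Integer as ℤ using (ℤ; +_; -[1+_]; _+_; _*_; -_; _-_; _/ℕ_)
open import Data.List using (List; []; _∷_; _++_; [_]; map; upTo; sum; length; filter; foldr; replicate)
open import Data.Product using (_×_; _,_; proj₁; proj₂)
open import Data.Bool using (Bool; true; false; if_then_else_)
open import Data.Nat.Properties using (_≟_)

-- Arithmetic helpers (divisors that are zero never occur in the lemma;
-- we return 0 then only to make the functions total without instances).

_/'_ : ℕ → ℕ → ℕ
n /' zero  = 0
n /' suc k = n ℕD./ suc k

_%'_ : ℕ → ℕ → ℕ
n %' zero  = n
n %' suc k = n ℕD.% suc k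

floorDiv : ℤ → ℕ → ℤ
floorDiv x zero    = + 0
floorDiv x (suc k) = x /ℕ suc k

ceilDiv : ℤ → ℕ → ℤ
ceilDiv x d = - floorDiv (- x) d

-- binomial coefficient with integer lower index (0 for negative index,
-- and N C k = 0 for k > N)
binomℤ : ℕ → ℤ → ℤ
binomℤ N (+ k)      = + (N C k)
binomℤ N -[1+ k ]   = + 0

clampℕ : ℤ → ℕ
clampℕ (+ n)    = n
clampℕ -[1+ n ] = 0

-- Σ_{i=a}^{b} g i over integers (empty, i.e. 0, if b < a)
sumRange : ℤ → ℤ → (ℤ → ℤ) → ℤ
sumRange a b g = foldr _+_ (+ 0) (map (λ k → g (a + + k)) (upTo (clampℕ (b - a + + 1))))

-- A v-shape: a multiset of v nonnegative integers, represented as a list.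
Shape : Set
Shape = List ℕ

μ : Shape → ℕ → ℕ
μ M x = length (filter (x ≟_) M)

fN : ℕ → ℕ → ℕ
fN N v = suc N /' v

dN : ℕ → ℕ → ℕ
dN N v = suc (fN N v) ℕ.* v ∸ N

special : ℕ → ℕ → Bool
special N v = (N %' v) ≡ᵇ (v ∸ 1)

-- v-1 entries summing to m, pairwise differing by at most 1:
-- r entries q+1 and (v-1-r) entries q, where m = q(v-1) + r.
balanced : ℕ → ℕ → List ℕ
balanced k m = replicate (m %' k) (suc (m /' k)) ++ replicate (k ∸ (m %' k)) (m /' k)

Lshape : ℕ → ℕ → ℕ → Shape
Lshape N v i = i ∷ balanced (v ∸ 1) (N ∸ i)

Lstar : ℕ → ℕ → Shape
Lstar N v = (f ∸ 1) ∷ (f ∸ 1) ∷ (replicate (v ∸ 3) f ++ [ suc f ])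
  where f = fN N v

sS : ℕ → ℕ → ℤ
sS N v = sumRange (f - d + + 2) (f - + 1) (λ i → (d - f - + 1 + i) * binomℤ N i)
  where f = + fN N v
        d = + dN N v

sS' : ℕ → ℕ → ℤ
sS' N v = sumRange (f - + v + + 1) (f - + 2) (λ i → (+ v - f + i) * binomℤ N i)
  where f = + fN N v

-- The type 𝓛(N,v): a list of (multiplicity, shape) pairs.
-- Multiplicities are integers; "well-defined" means they are all ≥ 0.

Lfamily : ℕ → ℕ → List (ℤ × Shape)
Lfamily N v =
  map (λ i → (binomℤ N (+ i) , Lshape N v i)) (upTo (f ∸ 1))
  ++ (if special N v
      then ((binomℤ N (+ (f ∸ 1)) - + 2 * c , Lshape N v (f ∸ 1))
            ∷ (if 3 ℕ.≤ᵇ v then [ (c , Lstar N v) ] else []))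
      else ((binomℤ N (+ (f ∸ 1)) , Lshape N v (f ∸ 1))
            ∷ [ (floorDiv (binomℤ N (+ f) - sS N v) (dN N v) , Lshape N v f) ]))
  where
    f = fN N v
    c = ceilDiv (sS' N v) (suc v)

WellDefined : List (ℤ × Shape) → Set
WellDefined [] = Data.Unit.⊤
  where import Data.Unit
WellDefined ((m , M) ∷ rest) = (+ 0 ℤ.≤ m) × WellDefined rest

totalμ : List (ℤ × Shape) → ℕ → ℤ
totalμ ℒ x = foldr _+_ (+ 0) (map (λ p → proj₁ p * + μ (proj₂ p) x) ℒ)

Admissible : ℕ → List (ℤ × Shape) → Set
Admissible N ℒ = (x : ℕ) → x ℕ.≤ N → totalμ ℒ x ℤ.≤ + (N C x)

-- For v = 2 the shapes are L_i = {i, N − i}.  A value x lies in exactly one of the first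
-- k pairs when x < k or N − x < k, and that pair is L_{min(x, N−x)}, taken C(N, x) times;
-- the values in the window [k, N − k] are not hit at all.  For odd N the pairs i ≤ (N−1)/2
-- cover every value once, and for even N the window is the single middle value N/2, which
-- the ⌊C(N, N/2)/2⌋ copies of L_{N/2} = {N/2, N/2} hit twice each.
-- For v ∈ {N, N + 1} one has f = 1; the sum s′ has only negative indices, and s only its
-- term at 0, namely N − 2.  So 𝓛 is one copy of L_0 = {0, 2, 1, …, 1} resp. {0, 1, …, 1}
-- plus zero copies of a second shape, and each entry x occurs at most C(N, x) times.
module Submission where

open import Defs
open import Data.Nat as ℕ using (ℕ; zero; suc; _≤_; _<_; z≤n; s≤s; _∸_; _≡ᵇ_)
import Data.Nat.Properties as ℕP
import Data.Nat.DivMod as ℕD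
open import Data.Nat.Divisibility using (_∣_; divides)
open import Data.Nat.Combinatorics using (_C_; nC1≡n; nCk≡nC[n∸k]; k>n⇒nCk≡0; nCk+nC[k+1]≡[n+1]C[k+1])
open import Data.Integer as ℤ using (ℤ; +_; -[1+_]; _+_; _*_; -_; _-_; +≤+; +<+)
import Data.Integer.Properties as ℤP
open import Data.Integer.Tactic.RingSolver using (solve-∀)
import Data.Nat.Tactic.RingSolver as NS
open import Data.List using (List; []; _∷_; _++_; [_]; map; upTo; foldr; replicate; length)
import Data.List.Properties as LP
open import Data.List.Relation.Unary.All as All using (All; []; _∷_)
open import Data.List.Relation.Unary.All.Properties using (all-upTo; map⁺)
open import Data.Product using (_×_; _,_; proj₁; proj₂)
open import Data.Sum using (_⊎_; inj₁; inj₂)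
open import Data.Unit using (tt)
open import Data.Bool using (Bool; true; false; if_then_else_)
open import Data.Bool.Properties using (T-≡)
open import Function.Bundles using (Equivalence)
open import Relation.Nullary using (yes; no; contradiction)
open import Relation.Binary using (tri<; tri≈; tri>)
open import Relation.Binary.PropositionalEquality hiding ([_])

μ-∷-self : ∀ a M → μ (a ∷ M) a ≡ suc (μ M a)
μ-∷-self a M = cong length (LP.filter-accept (a ℕP.≟_) refl)

μ-∷-≢ : ∀ {a x} M → x ≢ a → μ (a ∷ M) x ≡ μ M x
μ-∷-≢ M x≢a = cong length (LP.filter-reject (_ ℕP.≟_) x≢a)

μ-replicate-self : ∀ n a → μ (replicate n a) a ≡ n
μ-replicate-self zero    a = refl
μ-replicate-self (suc n) a = trans (μ-∷-self a (replicate n a)) (cong suc (μ-replicate-self n a))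

μ-replicate-≢ : ∀ n {a x} → x ≢ a → μ (replicate n a) x ≡ 0
μ-replicate-≢ zero    x≢a = refl
μ-replicate-≢ (suc n) x≢a = trans (μ-∷-≢ (replicate n _) x≢a) (μ-replicate-≢ n x≢a)

totalμ-++ : ∀ ℒ ℒ′ x → totalμ (ℒ ++ ℒ′) x ≡ totalμ ℒ x + totalμ ℒ′ x
totalμ-++ []      ℒ′ x = sym (ℤP.+-identityˡ _)
totalμ-++ (p ∷ ℒ) ℒ′ x =
  trans (cong (_+_ (proj₁ p * + μ (proj₂ p) x)) (totalμ-++ ℒ ℒ′ x))
        (sym (ℤP.+-assoc (proj₁ p * + μ (proj₂ p) x) (totalμ ℒ x) (totalμ ℒ′ x)))

totalμ-singleton : ∀ p x → totalμ [ p ] x ≡ proj₁ p * + μ (proj₂ p) x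
totalμ-singleton p x = ℤP.+-identityʳ _

WellDefined-++ : ∀ ℒ {ℒ′} → WellDefined ℒ → WellDefined ℒ′ → WellDefined (ℒ ++ ℒ′)
WellDefined-++ []      _        wd′ = wd′
WellDefined-++ (_ ∷ ℒ) (m≥0 , wd) wd′ = m≥0 , WellDefined-++ ℒ wd wd′

WellDefined-map : ∀ {A : Set} (F : A → ℤ × Shape) → (∀ a → + 0 ℤ.≤ proj₁ (F a)) →
                  ∀ xs → WellDefined (map F xs)
WellDefined-map F F≥0 []       = tt
WellDefined-map F F≥0 (a ∷ xs) = F≥0 a , WellDefined-map F F≥0 xs

map-upTo-suc : ∀ {A : Set} (F : ℕ → A) k → map F (upTo (suc k)) ≡ map F (upTo k) ++ [ F k ]
map-upTo-suc F k = trans (cong (map F) (sym (LP.upTo-∷ʳ k))) (LP.map-++ F (upTo k) [ k ])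

foldr-+-zeros : ∀ {xs} z → All (_≡ + 0) xs → foldr _+_ z xs ≡ z
foldr-+-zeros z []           = refl
foldr-+-zeros z (refl ∷ x≡0) = trans (ℤP.+-identityˡ _) (foldr-+-zeros z x≡0)

sumRange-index : ∀ a b {k} → k < clampℕ (b - a + + 1) → a + + k ℤ.≤ b
sumRange-index a b {k} k<n with b - a + + 1 in eq
... | + n = ℤP.i-j≤0⇒i≤j (subst (ℤ._≤ + 0) (shift a b (+ k)) (ℤP.i≤j⇒i-j≤0 k≤b-a))
  where
    shift : ∀ a b c → c - (b - a) ≡ a + c - b
    shift = solve-∀
    pred-+1 : ∀ c → - + 1 + (c + + 1) ≡ c
    pred-+1 = solve-∀
    k≤b-a : + k ℤ.≤ b - a
    k≤b-a = subst (+ k ℤ.≤_) (trans (cong ℤ.pred (sym eq)) (pred-+1 (b - a))) (ℤP.i<j⇒i≤pred[j] (+<+ k<n))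

sumRange-vanishing : ∀ a b g → (∀ i → a ℤ.≤ i → i ℤ.≤ b → g i ≡ + 0) → sumRange a b g ≡ + 0
sumRange-vanishing a b g g≡0 = foldr-+-zeros (+ 0)
  (map⁺ (All.map (λ k<n → g≡0 _ (ℤP.i≤i+j _ _) (sumRange-index a b k<n)) (all-upTo _)))

sumRange-last : ∀ a b g → a ℤ.≤ b → (∀ i → a ℤ.≤ i → i ℤ.< b → g i ≡ + 0) → sumRange a b g ≡ g b
sumRange-last a b g a≤b g≡0 = begin
    sumRange a b g
  ≡⟨ cong (λ t → foldr _+_ (+ 0) (map h (upTo (clampℕ t)))) length≡ ⟩
    foldr _+_ (+ 0) (map h (upTo (suc m)))
  ≡⟨ cong (foldr _+_ (+ 0)) (map-upTo-suc h m) ⟩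
    foldr _+_ (+ 0) (map h (upTo m) ++ [ h m ])
  ≡⟨ LP.foldr-++ _+_ (+ 0) (map h (upTo m)) [ h m ] ⟩
    foldr _+_ (h m + + 0) (map h (upTo m))
  ≡⟨ foldr-+-zeros (h m + + 0) (map⁺ (All.map below (all-upTo m))) ⟩
    h m + + 0
  ≡⟨ trans (ℤP.+-identityʳ (h m)) (cong g a+m≡b) ⟩
    g b
  ∎
  where
    open ≡-Reasoning
    h : ℕ → ℤ
    h k = g (a + + k)
    m = ℤ.∣ b - a ∣
    m≡b-a : + m ≡ b - a
    m≡b-a = ℤP.0≤i⇒+∣i∣≡i (ℤP.i≤j⇒0≤j-i a≤b)
    a+[b-a]≡b : ∀ a b → a + (b - a) ≡ b
    a+[b-a]≡b = solve-∀
    a+m≡b : a + + m ≡ b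
    a+m≡b = trans (cong (_+_ a) m≡b-a) (a+[b-a]≡b a b)
    length≡ : b - a + + 1 ≡ + suc m
    length≡ = trans (cong (_+ + 1) (sym m≡b-a)) (cong +_ (ℕP.+-comm m 1))
    below : ∀ {k} → k < m → h k ≡ + 0
    below k<m = g≡0 _ (ℤP.i≤i+j _ _) (subst (a + + _ ℤ.<_) a+m≡b (ℤP.+-monoʳ-< a (+<+ k<m)))

sumRange-empty : ∀ a g → sumRange a (a - + 1) g ≡ + 0
sumRange-empty a g = cong (λ t → foldr _+_ (+ 0) (map (λ k → g (a + + k)) (upTo (clampℕ t)))) (length≡0 a)
  where
    length≡0 : ∀ a → a - + 1 - a + + 1 ≡ + 0
    length≡0 = solve-∀

balanced-one : ∀ m → balanced 1 m ≡ [ m ]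
balanced-one m rewrite ℕD.n%1≡0 m | ℕD.n/1≡n m = refl

pairs : ℕ → ℕ → List (ℤ × Shape)
pairs N k = map (λ i → (binomℤ N (+ i) , Lshape N 2 i)) (upTo k)

pairs-suc : ∀ N k x →
  totalμ (pairs N (suc k)) x ≡ totalμ (pairs N k) x + + (N C k) * + μ (k ∷ N ∸ k ∷ []) x
pairs-suc N k x = begin
    totalμ (pairs N (suc k)) x
  ≡⟨ cong (λ ℒ → totalμ ℒ x) (map-upTo-suc _ k) ⟩
    totalμ (pairs N k ++ [ (binomℤ N (+ k) , Lshape N 2 k) ]) x
  ≡⟨ totalμ-++ (pairs N k) _ x ⟩
    totalμ (pairs N k) x + totalμ [ (binomℤ N (+ k) , Lshape N 2 k) ] x
  ≡⟨ cong (_+_ (totalμ (pairs N k) x)) (totalμ-singleton (binomℤ N (+ k) , Lshape N 2 k) x) ⟩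
    totalμ (pairs N k) x + + (N C k) * + μ (k ∷ balanced 1 (N ∸ k)) x
  ≡⟨ cong (λ M → totalμ (pairs N k) x + + (N C k) * + μ (k ∷ M) x) (balanced-one (N ∸ k)) ⟩
    totalμ (pairs N k) x + + (N C k) * + μ (k ∷ N ∸ k ∷ []) x
  ∎
  where open ≡-Reasoning

pairs-suc-miss : ∀ N k {x} → x ≢ k → x ≢ N ∸ k → totalμ (pairs N (suc k)) x ≡ totalμ (pairs N k) x
pairs-suc-miss N k {x} x≢k x≢r = begin
    totalμ (pairs N (suc k)) x
  ≡⟨ pairs-suc N k x ⟩
    totalμ (pairs N k) x + + (N C k) * + μ (k ∷ N ∸ k ∷ []) x
  ≡⟨ cong (λ c → totalμ (pairs N k) x + + (N C k) * + c) (trans (μ-∷-≢ _ x≢k) (μ-∷-≢ [] x≢r)) ⟩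
    totalμ (pairs N k) x + + (N C k) * + 0
  ≡⟨ cong (_+_ (totalμ (pairs N k) x)) (ℤP.*-zeroʳ (+ (N C k))) ⟩
    totalμ (pairs N k) x + + 0
  ≡⟨ ℤP.+-identityʳ _ ⟩
    totalμ (pairs N k) x
  ∎
  where open ≡-Reasoning

pairs-suc-hit : ∀ N k {x} → (x ≡ k × x ≢ N ∸ k) ⊎ (x ≢ k × x ≡ N ∸ k) →
                totalμ (pairs N (suc k)) x ≡ totalμ (pairs N k) x + + (N C k)
pairs-suc-hit N k {x} hit = begin
    totalμ (pairs N (suc k)) x
  ≡⟨ pairs-suc N k x ⟩
    totalμ (pairs N k) x + + (N C k) * + μ (k ∷ N ∸ k ∷ []) x
  ≡⟨ cong (λ c → totalμ (pairs N k) x + + (N C k) * + c) (μ≡1 hit) ⟩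
    totalμ (pairs N k) x + + (N C k) * + 1
  ≡⟨ cong (_+_ (totalμ (pairs N k) x)) (ℤP.*-identityʳ (+ (N C k))) ⟩
    totalμ (pairs N k) x + + (N C k)
  ∎
  where
    open ≡-Reasoning
    μ≡1 : (x ≡ k × x ≢ N ∸ k) ⊎ (x ≢ k × x ≡ N ∸ k) → μ (k ∷ N ∸ k ∷ []) x ≡ 1
    μ≡1 (inj₁ (refl , x≢r)) = trans (μ-∷-self x _) (cong suc (μ-∷-≢ [] x≢r))
    μ≡1 (inj₂ (x≢k , refl)) = trans (μ-∷-≢ _ x≢k) (μ-∷-self x [])

pairs-inside : ∀ N k {x} → k ≤ x → x ℕ.+ k ≤ N → totalμ (pairs N k) x ≡ + 0
pairs-inside N zero    _   _     = refl
pairs-inside N (suc k) {x} k<x x+k<N =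
  trans (pairs-suc-miss N k (ℕP.>⇒≢ k<x) (ℕP.<⇒≢ x<N∸k)) (pairs-inside N k (ℕP.<⇒≤ k<x) x+k≤N)
  where
    x<N∸k : x < N ∸ k
    x<N∸k = ℕP.m+n≤o⇒m≤o∸n (suc x) (subst (_≤ N) (ℕP.+-suc x k) x+k<N)
    x+k≤N : x ℕ.+ k ≤ N
    x+k≤N = ℕP.≤-trans (ℕP.+-monoʳ-≤ x (ℕP.n≤1+n k)) x+k<N

module _ (N k : ℕ) (2k<N : k ℕ.+ k < N) where
  private
    k≤N : k ≤ N
    k≤N = ℕP.≤-trans (ℕP.m≤m+n k k) (ℕP.<⇒≤ 2k<N)
    k<N∸k : k < N ∸ k
    k<N∸k = ℕP.m+n≤o⇒m≤o∸n (suc k) 2k<N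

  pairs-outside-suc : (∀ {x} → x < k ⊎ N < x ℕ.+ k → totalμ (pairs N k) x ≡ + (N C x)) →
                      ∀ {x} → x < suc k ⊎ N < x ℕ.+ suc k → totalμ (pairs N (suc k)) x ≡ + (N C x)
  pairs-outside-suc outside-k {x} outside with ℕP.<-cmp x k
  ... | tri< x<k _ _ =
    trans (pairs-suc-miss N k (ℕP.<⇒≢ x<k) (ℕP.<⇒≢ (ℕP.<-trans x<k k<N∸k))) (outside-k (inj₁ x<k))
  ... | tri≈ _ refl _ = begin
      totalμ (pairs N (suc k)) k
    ≡⟨ pairs-suc-hit N k (inj₁ (refl , ℕP.<⇒≢ k<N∸k)) ⟩
      totalμ (pairs N k) k + + (N C k)
    ≡⟨ cong (_+ + (N C k)) (pairs-inside N k ℕP.≤-refl (ℕP.<⇒≤ 2k<N)) ⟩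
      + (N C k)
    ∎
    where open ≡-Reasoning
  ... | tri> _ _ k<x with ℕP.<-cmp x (N ∸ k)
  ...   | tri< x<N∸k _ _ = contradiction outside λ
            { (inj₁ x<k+1) → ℕP.<-irrefl refl (ℕP.<-≤-trans k<x (ℕP.≤-pred x<k+1))
            ; (inj₂ N<x+k+1) → ℕP.<-irrefl refl (ℕP.<-≤-trans N<x+k+1 x+k+1≤N) }
    where
      x+k+1≤N : x ℕ.+ suc k ≤ N
      x+k+1≤N = subst₂ _≤_ (sym (ℕP.+-suc x k)) (ℕP.m∸n+n≡m k≤N) (ℕP.+-monoˡ-≤ k x<N∸k)
  ...   | tri≈ _ refl _ = begin
      totalμ (pairs N (suc k)) (N ∸ k)
    ≡⟨ pairs-suc-hit N k (inj₂ (ℕP.>⇒≢ k<x , refl)) ⟩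
      totalμ (pairs N k) (N ∸ k) + + (N C k)
    ≡⟨ cong (_+ + (N C k)) (pairs-inside N k (ℕP.<⇒≤ k<x) (ℕP.≤-reflexive (ℕP.m∸n+n≡m k≤N))) ⟩
      + (N C k)
    ≡⟨ cong +_ (nCk≡nC[n∸k] k≤N) ⟩
      + (N C (N ∸ k))
    ∎
    where open ≡-Reasoning
  ...   | tri> _ _ N∸k<x =
    trans (pairs-suc-miss N k (ℕP.>⇒≢ k<x) (ℕP.>⇒≢ N∸k<x))
          (outside-k (inj₂ (subst (_< x ℕ.+ k) (ℕP.m∸n+n≡m k≤N) (ℕP.+-monoˡ-< k N∸k<x))))

pairs-outside : ∀ N k {x} → k ℕ.+ k ≤ suc N → x < k ⊎ N < x ℕ.+ k → totalμ (pairs N k) x ≡ + (N C x)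
pairs-outside N zero    {x} _ (inj₂ N<x+0) =
  cong +_ (sym (k>n⇒nCk≡0 (subst (N <_) (ℕP.+-identityʳ x) N<x+0)))
pairs-outside N (suc k) 2k+2≤N+1 = pairs-outside-suc N k 2k<N (pairs-outside N k (ℕP.<⇒≤ (ℕP.m<n⇒m<1+n 2k<N)))
  where
    2k<N : k ℕ.+ k < N
    2k<N = ℕP.≤-pred (subst (_≤ suc N) (cong suc (ℕP.+-suc k k)) 2k+2≤N+1)

pairs-bounded : ∀ N k → k ℕ.+ k ≤ suc N → ∀ x → totalμ (pairs N k) x ℤ.≤ + (N C x)
pairs-bounded N k 2k≤N+1 x with x ℕP.<? k | x ℕ.+ k ℕP.≤? N
... | yes x<k | _        = ℤP.≤-reflexive (pairs-outside N k 2k≤N+1 (inj₁ x<k))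
... | no x≮k  | yes x+k≤N = subst (ℤ._≤ + (N C x)) (sym (pairs-inside N k (ℕP.≮⇒≥ x≮k) x+k≤N)) (+≤+ z≤n)
... | no _    | no x+k≰N  = ℤP.≤-reflexive (pairs-outside N k 2k≤N+1 (inj₂ (ℕP.≰⇒> x+k≰N)))

pairs-wellDefined : ∀ N k → WellDefined (pairs N k)
pairs-wellDefined N k = WellDefined-map _ (λ _ → +≤+ z≤n) (upTo k)

pairs-suc-≡ : ∀ N k ℒ → pairs N k ++ (binomℤ N (+ k) , Lshape N 2 k) ∷ ℒ ≡ pairs N (suc k) ++ ℒ
pairs-suc-≡ N k ℒ = begin
    pairs N k ++ [ (binomℤ N (+ k) , Lshape N 2 k) ] ++ ℒ
  ≡⟨ LP.++-assoc (pairs N k) _ ℒ ⟨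
    (pairs N k ++ [ (binomℤ N (+ k) , Lshape N 2 k) ]) ++ ℒ
  ≡⟨ cong (_++ ℒ) (map-upTo-suc _ k) ⟨
    pairs N (suc k) ++ ℒ
  ∎
  where open ≡-Reasoning

sTerm : ℕ → ℕ → ℕ → ℤ → ℤ
sTerm N f d i = (+ d - + f - + 1 + i) * binomℤ N i

sWith : ℕ → ℕ → ℕ → ℤ
sWith N f d = sumRange (+ f - + d + + 2) (+ f - + 1) (sTerm N f d)

s′Term : ℕ → ℕ → ℕ → ℤ → ℤ
s′Term N v f i = (+ v - + f + i) * binomℤ N i

s′With : ℕ → ℕ → ℕ → ℤ
s′With N v f = sumRange (+ f - + v + + 1) (+ f - + 2) (s′Term N v f)

-- 𝓛(N, v) with f, [N ≡ v − 1 (mod v)], c = ⌈s′/(v+1)⌉ and q = ⌊(C(N,f) − s)/d⌋ as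
-- parameters, so that each case can substitute their computed values.
LfamilyWith : ℕ → ℕ → ℕ → Bool → ℤ → ℤ → List (ℤ × Shape)
LfamilyWith N v f special c q =
  map (λ i → (binomℤ N (+ i) , Lshape N v i)) (upTo (f ∸ 1))
  ++ (if special
      then ((binomℤ N (+ (f ∸ 1)) - + 2 * c , Lshape N v (f ∸ 1))
            ∷ (if 3 ℕ.≤ᵇ v then [ (c , Lstar N v) ] else []))
      else ((binomℤ N (+ (f ∸ 1)) , Lshape N v (f ∸ 1))
            ∷ [ (q , Lshape N v f) ]))

Lfamily-≡ : ∀ N v {f sp d} → fN N v ≡ f → special N v ≡ sp → suc f ℕ.* v ∸ N ≡ d →
  Lfamily N v ≡ LfamilyWith N v f sp (ceilDiv (s′With N v f) (suc v)) (floorDiv (binomℤ N (+ f) - sWith N f d) d)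
Lfamily-≡ N v refl refl refl = refl

WellDefinedAdmissible : ℕ → List (ℤ × Shape) → Set
WellDefinedAdmissible N ℒ = WellDefined ℒ × Admissible N ℒ

Lfamily-2-even : ∀ m → let N = suc m ℕ.* 2 in
  Lfamily N 2 ≡ pairs N (suc m) ++ [ (+ ((N C suc m) ℕD./ 2) , Lshape N 2 (suc m)) ]
Lfamily-2-even m = begin
    Lfamily N 2
  ≡⟨ Lfamily-≡ N 2 f≡h (cong (_≡ᵇ 1) (ℕD.m*n%n≡0 h 2)) (ℕP.m+n∸n≡m 2 N) ⟩
    LfamilyWith N 2 h false (ceilDiv (s′With N 2 h) 3) (floorDiv (binomℤ N (+ h) - sWith N h 2) 2)
  ≡⟨ cong (LfamilyWith N 2 h false (ceilDiv (s′With N 2 h) 3)) q≡ ⟩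
    pairs N m ++ (binomℤ N (+ m) , Lshape N 2 m) ∷ [ (+ ((N C h) ℕD./ 2) , Lshape N 2 h) ]
  ≡⟨ pairs-suc-≡ N m _ ⟩
    pairs N h ++ [ (+ ((N C h) ℕD./ 2) , Lshape N 2 h) ]
  ∎
  where
    open ≡-Reasoning
    h = suc m
    N = h ℕ.* 2
    f≡h : fN N 2 ≡ h
    f≡h = trans (ℕD.+-distrib-/-∣ʳ 1 2∣N) (ℕD.m*n/n≡m h 2)
      where 2∣N : 2 ∣ N
            2∣N = divides h refl
    empty : ∀ a → a - + 1 ≡ a - + 2 + + 2 - + 1
    empty = solve-∀
    s≡0 : sWith N h 2 ≡ + 0
    s≡0 = trans (cong (λ b → sumRange (+ h - + 2 + + 2) b (sTerm N h 2)) (empty (+ h)))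
                (sumRange-empty (+ h - + 2 + + 2) (sTerm N h 2))
    q≡ : floorDiv (binomℤ N (+ h) - sWith N h 2) 2 ≡ + ((N C h) ℕD./ 2)
    q≡ = trans (cong (λ s → floorDiv (binomℤ N (+ h) - s) 2) s≡0) (cong (λ t → floorDiv t 2) (ℤP.+-identityʳ (+ (N C h))))

pairs-middle-wellDefinedAdmissible : ∀ N h q → h ℕ.+ h ≡ N → q ℕ.* 2 ≤ N C h →
  WellDefinedAdmissible N (pairs N h ++ [ (+ q , Lshape N 2 h) ])
pairs-middle-wellDefinedAdmissible N h q h+h≡N 2q≤C =
  WellDefined-++ (pairs N h) (pairs-wellDefined N h) (+≤+ z≤n , tt) , admissible
  where
    N∸h≡h : N ∸ h ≡ h
    N∸h≡h = trans (cong (_∸ h) (sym h+h≡N)) (ℕP.m+n∸n≡m h h)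
    totalμ≡ : ∀ x → totalμ (pairs N h ++ [ (+ q , Lshape N 2 h) ]) x ≡ totalμ (pairs N h) x + + q * + μ (h ∷ h ∷ []) x
    totalμ≡ x = begin
        totalμ (pairs N h ++ [ (+ q , Lshape N 2 h) ]) x
      ≡⟨ totalμ-++ (pairs N h) _ x ⟩
        totalμ (pairs N h) x + totalμ [ (+ q , Lshape N 2 h) ] x
      ≡⟨ cong (_+_ (totalμ (pairs N h) x)) (totalμ-singleton (+ q , Lshape N 2 h) x) ⟩
        totalμ (pairs N h) x + + q * + μ (h ∷ balanced 1 (N ∸ h)) x
      ≡⟨ cong (λ M → totalμ (pairs N h) x + + q * + μ (h ∷ M) x) (trans (balanced-one (N ∸ h)) (cong [_] N∸h≡h)) ⟩
        totalμ (pairs N h) x + + q * + μ (h ∷ h ∷ []) x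
      ∎
      where open ≡-Reasoning
    bounded : ∀ x → totalμ (pairs N h) x + + q * + μ (h ∷ h ∷ []) x ℤ.≤ + (N C x)
    bounded x with x ℕP.≟ h
    ... | yes refl = subst (ℤ._≤ + (N C x)) (sym total≡2q) (+≤+ 2q≤C)
      where
        total≡2q : totalμ (pairs N x) x + + q * + μ (x ∷ x ∷ []) x ≡ + (q ℕ.* 2)
        total≡2q = begin
            totalμ (pairs N x) x + + q * + μ (x ∷ x ∷ []) x
          ≡⟨ cong₂ (λ t c → t + + q * + c) (pairs-inside N x ℕP.≤-refl (ℕP.≤-reflexive h+h≡N))
                    (trans (μ-∷-self x (x ∷ [])) (cong suc (μ-∷-self x []))) ⟩
            + 0 + + q * + 2
          ≡⟨ trans (ℤP.+-identityˡ (+ q * + 2)) (sym (ℤP.pos-* q 2)) ⟩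
            + (q ℕ.* 2)
          ∎
          where open ≡-Reasoning
    ... | no x≢h rewrite μ-∷-≢ (h ∷ []) x≢h | μ-∷-≢ [] x≢h | ℤP.*-zeroʳ (+ q) | ℤP.+-identityʳ (totalμ (pairs N h) x) =
      pairs-bounded N h (subst (_≤ suc N) (sym h+h≡N) (ℕP.n≤1+n N)) x
    admissible : Admissible N (pairs N h ++ [ (+ q , Lshape N 2 h) ])
    admissible x _ = subst (ℤ._≤ + (N C x)) (sym (totalμ≡ x)) (bounded x)

Lfamily-2-odd : ∀ m → let N = suc (m ℕ.* 2) in Lfamily N 2 ≡ pairs N (suc m)
Lfamily-2-odd m = begin
    Lfamily N 2
  ≡⟨ Lfamily-≡ N 2 (ℕD.m*n/n≡m h 2) (cong (_≡ᵇ 1) (ℕD.[m+kn]%n≡m%n 1 m 2)) refl ⟩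
    LfamilyWith N 2 h true (ceilDiv (s′With N 2 h) 3) q
  ≡⟨ cong (λ c → LfamilyWith N 2 h true (ceilDiv c 3) q) s′≡0 ⟩
    pairs N m ++ [ (binomℤ N (+ m) - + 0 , Lshape N 2 m) ]
  ≡⟨ cong (λ c → pairs N m ++ [ (c , Lshape N 2 m) ]) (ℤP.+-identityʳ (binomℤ N (+ m))) ⟩
    pairs N m ++ [ (binomℤ N (+ m) , Lshape N 2 m) ]
  ≡⟨ pairs-suc-≡ N m [] ⟩
    pairs N h ++ []
  ≡⟨ LP.++-identityʳ (pairs N h) ⟩
    pairs N h
  ∎
  where
    open ≡-Reasoning
    h = suc m
    N = suc (m ℕ.* 2)
    d = suc h ℕ.* 2 ∸ N
    q = floorDiv (binomℤ N (+ h) - sWith N h d) d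
    empty : ∀ a → a - + 2 ≡ a - + 2 + + 1 - + 1
    empty = solve-∀
    s′≡0 : s′With N 2 h ≡ + 0
    s′≡0 = trans (cong (λ b → sumRange (+ h - + 2 + + 1) b (s′Term N 2 h)) (empty (+ h)))
                 (sumRange-empty (+ h - + 2 + + 1) (s′Term N 2 h))

data Parity : ℕ → Set where
  even : ∀ m → Parity (m ℕ.* 2)
  odd  : ∀ m → Parity (suc (m ℕ.* 2))

parity : ∀ n → Parity n
parity zero = even 0
parity (suc n) with parity n
... | even m = odd m
... | odd m  = even (suc m)

m+m≡m*2 : ∀ m → m ℕ.+ m ≡ m ℕ.* 2
m+m≡m*2 = NS.solve-∀

Lfamily-2-wellDefinedAdmissible : ∀ N → 1 ≤ N → WellDefinedAdmissible N (Lfamily N 2)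
Lfamily-2-wellDefinedAdmissible N 1≤N with parity N
... | even (suc m) = subst (WellDefinedAdmissible N) (sym (Lfamily-2-even m))
  (pairs-middle-wellDefinedAdmissible N (suc m) _ (m+m≡m*2 (suc m)) (ℕD.m/n*n≤m (N C suc m) 2))
... | odd m = subst (WellDefinedAdmissible N) (sym (Lfamily-2-odd m))
  (pairs-wellDefined N (suc m) , λ x _ → pairs-bounded N (suc m) (ℕP.≤-reflexive (m+m≡m*2 (suc m))) x)

totalμ-one-zero : ∀ M M′ x → totalμ ((+ 1 , M) ∷ (+ 0 , M′) ∷ []) x ≡ + μ M x
totalμ-one-zero M M′ x = trans (ℤP.+-identityʳ (+ 1 * + μ M x)) (ℤP.*-identityˡ (+ μ M x))

one-zero-wellDefinedAdmissible : ∀ N M M′ → (∀ x → μ M x ≤ N C x) →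
  WellDefinedAdmissible N ((+ 1 , M) ∷ (+ 0 , M′) ∷ [])
one-zero-wellDefinedAdmissible N M M′ μ≤C =
  (+≤+ z≤n , +≤+ z≤n , tt) , λ x _ → subst (ℤ._≤ + (N C x)) (sym (totalμ-one-zero M M′ x)) (+≤+ (μ≤C x))

0<nCk : ∀ n k → k ≤ n → 0 < n C k
0<nCk n       zero    _         = s≤s z≤n
0<nCk (suc n) (suc k) (s≤s k≤n) =
  subst (0 <_) (nCk+nC[k+1]≡[n+1]C[k+1] n k) (ℕP.<-≤-trans (0<nCk n k k≤n) (ℕP.m≤m+n (n C k) _))

balanced-self : ∀ k → balanced (suc k) (suc k) ≡ replicate (suc k) 1
balanced-self k =
  cong₂ (λ r q → replicate r (suc q) ++ replicate (suc k ∸ r) q) (ℕD.n%n≡0 (suc k)) (ℕD.n/n≡1 (suc k))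

Lfamily-N+1 : ∀ j → let N = suc (suc j) in
  Lfamily N (suc N) ≡ (+ 1 , 0 ∷ replicate N 1) ∷ (+ 0 , Lstar N (suc N)) ∷ []
Lfamily-N+1 j = begin
    Lfamily N (suc N)
  ≡⟨ Lfamily-≡ N (suc N) (ℕD.n/n≡1 (suc N)) special≡true refl ⟩
    LfamilyWith N (suc N) 1 true (ceilDiv (s′With N (suc N) 1) (suc (suc N))) q
  ≡⟨ cong (λ c → LfamilyWith N (suc N) 1 true (ceilDiv c (suc (suc N))) q) s′≡0 ⟩
    (+ 1 , 0 ∷ balanced N N) ∷ (+ 0 , Lstar N (suc N)) ∷ []
  ≡⟨ cong (λ M → (+ 1 , 0 ∷ M) ∷ (+ 0 , Lstar N (suc N)) ∷ []) (balanced-self (suc j)) ⟩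
    (+ 1 , 0 ∷ replicate N 1) ∷ (+ 0 , Lstar N (suc N)) ∷ []
  ∎
  where
    open ≡-Reasoning
    N = suc (suc j)
    d = 2 ℕ.* suc N ∸ N
    q = floorDiv (binomℤ N (+ 1) - sWith N 1 d) d
    special≡true : special N (suc N) ≡ true
    special≡true = trans (cong (_≡ᵇ N) (ℕD.m<n⇒m%n≡m (ℕP.n<1+n N))) (Equivalence.to T-≡ (ℕP.≡⇒≡ᵇ N N refl))
    s′≡0 : s′With N (suc N) 1 ≡ + 0
    s′≡0 = sumRange-vanishing (+ 1 - + suc N + + 1) (+ 1 - + 2) (s′Term N (suc N) 1) λ
      { -[1+ n ] _ _  → ℤP.*-zeroʳ (+ suc N - + 1 + -[1+ n ])
      ; (+ n)    _ () }

Lfamily-N+1-wellDefinedAdmissible : ∀ j → let N = suc (suc j) in WellDefinedAdmissible N (Lfamily N (suc N))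
Lfamily-N+1-wellDefinedAdmissible j = subst (WellDefinedAdmissible N) (sym (Lfamily-N+1 j))
  (one-zero-wellDefinedAdmissible N (0 ∷ replicate N 1) (Lstar N (suc N)) μ≤C)
  where
    N = suc (suc j)
    μ≤C : ∀ x → μ (0 ∷ replicate N 1) x ≤ N C x
    μ≤C zero          = ℕP.≤-reflexive (cong suc (μ-replicate-≢ N {1} {0} λ ()))
    μ≤C (suc zero)    = ℕP.≤-reflexive (trans (μ-replicate-self N 1) (sym (nC1≡n N)))
    μ≤C (suc (suc x)) = ℕP.≤-trans (ℕP.≤-reflexive (μ-replicate-≢ N {1} {suc (suc x)} λ ())) z≤n

[3+k]/[2+k]≡1 : ∀ k → (3 ℕ.+ k) ℕD./ (2 ℕ.+ k) ≡ 1
[3+k]/[2+k]≡1 k = trans (ℕD.m/n≡1+[m∸n]/n (ℕP.n≤1+n (2 ℕ.+ k))) (cong (λ t → suc (t ℕD./ (2 ℕ.+ k))) (ℕP.m+n∸n≡m 1 (2 ℕ.+ k)))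

balanced-self+1 : ∀ k → balanced (2 ℕ.+ k) (3 ℕ.+ k) ≡ 2 ∷ replicate (suc k) 1
balanced-self+1 k =
  cong₂ (λ r q → replicate r (suc q) ++ replicate (2 ℕ.+ k ∸ r) q) (ℕD.[m+n]%n≡m%n 1 (2 ℕ.+ k)) ([3+k]/[2+k]≡1 k)

Lfamily-N : ∀ j → let N = 3 ℕ.+ j in
  Lfamily N N ≡ (+ 1 , 0 ∷ 2 ∷ replicate (suc j) 1) ∷ (+ 0 , Lshape N N 1) ∷ []
Lfamily-N j = begin
    Lfamily N N
  ≡⟨ Lfamily-≡ N N ([3+k]/[2+k]≡1 (suc j)) (cong (_≡ᵇ (N ∸ 1)) (ℕD.n%n≡0 N)) d≡N ⟩
    LfamilyWith N N 1 false c (floorDiv (binomℤ N (+ 1) - sWith N 1 N) N)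
  ≡⟨ cong (LfamilyWith N N 1 false c) q≡0 ⟩
    (+ 1 , 0 ∷ balanced (2 ℕ.+ j) N) ∷ (+ 0 , Lshape N N 1) ∷ []
  ≡⟨ cong (λ M → (+ 1 , 0 ∷ M) ∷ (+ 0 , Lshape N N 1) ∷ []) (balanced-self+1 j) ⟩
    (+ 1 , 0 ∷ 2 ∷ replicate (suc j) 1) ∷ (+ 0 , Lshape N N 1) ∷ []
  ∎
  where
    open ≡-Reasoning
    N = 3 ℕ.+ j
    c = ceilDiv (s′With N N 1) (suc N)
    d≡N : 2 ℕ.* N ∸ N ≡ N
    d≡N = trans (cong (λ t → N ℕ.+ t ∸ N) (ℕP.+-identityʳ N)) (ℕP.m+n∸m≡n N N)
    a≤0 : + 1 - + N + + 2 ℤ.≤ + 0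
    a≤0 = subst (ℤ._≤ + 0) (lower (+ N)) (ℤP.i≤j⇒i-j≤0 {+ 3} {+ N} (+≤+ (s≤s (s≤s (s≤s z≤n)))))
      where lower : ∀ n → + 3 - n ≡ + 1 - n + + 2
            lower = solve-∀
    s≡N-2 : sWith N 1 N ≡ (+ N - + 1 - + 1 + + 0) * + 1
    s≡N-2 = sumRange-last (+ 1 - + N + + 2) (+ 0) (sTerm N 1 N) a≤0 λ
      { -[1+ n ] _ _        → ℤP.*-zeroʳ (+ N - + 1 - + 1 + -[1+ n ])
      ; (+ n)    _ (+<+ ()) }
    two : ∀ n → n - (n - + 1 - + 1 + + 0) * + 1 ≡ + 2
    two = solve-∀
    q≡0 : floorDiv (binomℤ N (+ 1) - sWith N 1 N) N ≡ + 0
    q≡0 = cong (λ t → floorDiv t N)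
      (trans (cong₂ (λ b s → + b - s) (nC1≡n N) s≡N-2) (two (+ N)))

Lfamily-N-wellDefinedAdmissible : ∀ j → let N = 3 ℕ.+ j in WellDefinedAdmissible N (Lfamily N N)
Lfamily-N-wellDefinedAdmissible j = subst (WellDefinedAdmissible N) (sym (Lfamily-N j))
  (one-zero-wellDefinedAdmissible N (0 ∷ 2 ∷ replicate (suc j) 1) (Lshape N N 1) μ≤C)
  where
    N = 3 ℕ.+ j
    μ≤C : ∀ x → μ (0 ∷ 2 ∷ replicate (suc j) 1) x ≤ N C x
    μ≤C zero                = ℕP.≤-reflexive (cong suc (μ-replicate-≢ (suc j) {1} {0} λ ()))
    μ≤C (suc zero)          = subst (μ (replicate (suc j) 1) 1 ≤_) (sym (nC1≡n N)) (ℕP.≤-trans (ℕP.≤-reflexive (μ-replicate-self (suc j) 1)) (ℕP.m≤n+m (suc j) 2))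
    μ≤C (suc (suc zero))    = subst (_≤ N C 2) (sym (cong suc (μ-replicate-≢ (suc j) {1} {2} λ ()))) (0<nCk N 2 (s≤s (s≤s z≤n)))
    μ≤C (suc (suc (suc x))) = ℕP.≤-trans (ℕP.≤-reflexive (μ-replicate-≢ (suc j) {1} {3 ℕ.+ x} λ ())) z≤n

lemma3p4 : (N v : ℕ) → 2 ≤ v → v ≤ suc N → (v ≡ 2 ⊎ v ≡ N ⊎ v ≡ suc N) →
    WellDefined (Lfamily N v) × Admissible N (Lfamily N v)
lemma3p4 N                   _ _        v≤N+1 (inj₁ refl)        = Lfamily-2-wellDefinedAdmissible N (ℕP.≤-pred v≤N+1)
lemma3p4 (suc zero)          _ (s≤s ()) _     (inj₂ (inj₁ refl))
lemma3p4 (suc (suc zero))    _ _        _     (inj₂ (inj₁ refl)) = Lfamily-2-wellDefinedAdmissible 2 (s≤s z≤n)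
lemma3p4 (suc (suc (suc j))) _ _        _     (inj₂ (inj₁ refl)) = Lfamily-N-wellDefinedAdmissible j
lemma3p4 zero                _ (s≤s ()) _     (inj₂ (inj₂ refl))
lemma3p4 (suc zero)          _ _        _     (inj₂ (inj₂ refl)) = Lfamily-2-wellDefinedAdmissible 1 (s≤s z≤n)
lemma3p4 (suc (suc j))       _ _        _     (inj₂ (inj₂ refl)) = Lfamily-N+1-wellDefinedAdmissible j
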